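{- Let $b\in\mathbb{Q}$ with $b\neq 0$ and let $\phi(z)=z+\frac{b}{z}$. If $P\in\mathbb{P}^1(\mathbb{Q})$ is a periodic point of $\phi$, then either $P=\infty$ or $P$ has exact period $2$.
   Context: $P$ is periodic if $\phi^n(P)=P$ for some $n\ge1$; it has exact period $n$ if $n$ is the least such integer. -}

module Defs where

open import Data.Nat using (ℕ; zero; suc)
open import Data.Maybe using (Maybe; just; nothing)
open import Data.Rational using (ℚ; 0ℚ; _+_; _÷_; _≟_; ≢-nonZero)
open import Relation.Nullary using (yes; no)
open import Relation.Binary.PropositionalEquality using (_≡_)

-- The projective line P¹(ℚ): nothing = ∞, just z = the affine point z.
P1 : Set
P1 = Maybe ℚ

∞ : P1
∞ = nothing

φ : ℚ → P1 → P1
φ b nothing = nothing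
φ b (just z) with z ≟ 0ℚ
... | yes _ = nothing
... | no z≢0 = just (z + (_÷_ b z {{≢-nonZero z≢0}}))

iter : (P1 → P1) → ℕ → P1 → P1
iter f zero x = x
iter f (suc n) x = f (iter f n x)

IsPeriodic : (P1 → P1) → P1 → Set
IsPeriodic f P = Σ ℕ λ n → iter f (suc n) P ≡ P
  where open import Data.Product using (Σ)

HasExactPeriod : (P1 → P1) → P1 → ℕ → Set
HasExactPeriod f P n =
  (1 ≤ n) × (iter f n P ≡ P) × (∀ m → 1 ≤ m → iter f m P ≡ P → n ≤ m)
  where open import Data.Product using (_×_)
        open import Data.Nat using (_≤_)

-- Put X(z) = z²/b. Then X(φ z) = (X z + 1)²/X z, and if X z = A/D in lowest terms, then
-- X(φ z) = (A + D)²/(A·D) is again in lowest terms. So the denominator of X can only grow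
-- along an orbit, and on a cycle it must stay constant: |A| = 1 at every point of the cycle.
-- As the numerator of X(φ z) is (A + D)², also |A + D| = 1, which forces X z = -1/2, that
-- is b = -2z². But then φ z = z + b/z = -z, and φ(-z) = z.
module Submission where

open import Data.Maybe using (just; nothing)
open import Data.Maybe.Properties using (just-injective)
open import Data.Nat as ℕ using (zero; suc; z≤n; s≤s)
import Data.Nat.Properties as ℕ
open import Data.Nat.Coprimality as Coprime using (Coprime; coprime-divisor)
open import Data.Nat.Divisibility using (_∣_; ∣-trans; ∣-antisym; n∣m*n)
open import Data.Nat.Tactic.RingSolver as ℕ-Solver using ()
open import Data.Integer as ℤ using (+_; -[1+_]; ∣_∣)
import Data.Integer.Properties as ℤ
import Data.Integer.Divisibility.Signed as ℤ
open import Data.Product using (_×_; _,_; proj₁; proj₂)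
open import Data.Rational
  using (ℚ; mkℚ; ↥_; ↧_; ↧ₙ_; 0ℚ; 1ℚ; -½; NonZero; ≢-nonZero; _≟_;
         _+_; _-_; _*_; -_; 1/_; _÷_; toℚᵘ)
open import Data.Rational.Properties
  using (*-zeroʳ; 1≢0; ↥p≡0⇒p≡0; ↥-neg;
         toℚᵘ-cong; toℚᵘ-homo-+; toℚᵘ-homo-*; *-inverseʳ)
import Data.Rational.Unnormalised as ℚᵘ
import Data.Rational.Unnormalised.Properties as ℚᵘ
open import Data.Rational.Solver using (module +-*-Solver)
open import Data.Sum using (_⊎_; inj₁; inj₂)
open import Relation.Binary.PropositionalEquality
open import Relation.Nullary using (yes; no; contradiction)

open import Defs

open +-*-Solver using (solve; _:=_; _:+_; _:-_; _:*_; :-_; con)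

coprime-*ʳ : ∀ {m n o} → Coprime m n → Coprime m o → Coprime m (n ℕ.* o)
coprime-*ʳ cop-n cop-o (d∣m , d∣no) = cop-o (d∣m , coprime-divisor cop-dn d∣no)
  where
  cop-dn : Coprime _ _
  cop-dn (e∣d , e∣n) = cop-n (∣-trans e∣d d∣m , e∣n)

coprime-+ˡ : ∀ i n → Coprime ∣ i ∣ n → Coprime ∣ i ℤ.+ + n ∣ ∣ i ∣
coprime-+ˡ i n cop {d} (d∣i+n , d∣i) =
  cop (d∣i , ℤ.∣⇒∣ᵤ (ℤ.∣m+n∣m⇒∣n {+ d} {i} {+ n} (ℤ.∣ᵤ⇒∣ d∣i+n) (ℤ.∣ᵤ⇒∣ d∣i)))

coprime-+ʳ : ∀ i n → Coprime ∣ i ∣ n → Coprime ∣ i ℤ.+ + n ∣ n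
coprime-+ʳ i n cop {d} (d∣i+n , d∣n) =
  cop (ℤ.∣⇒∣ᵤ (ℤ.∣m+n∣n⇒∣m {+ d} {i} {+ n} (ℤ.∣ᵤ⇒∣ d∣i+n) (ℤ.∣ᵤ⇒∣ {+ d} {+ n} d∣n)) , d∣n)

reduced-fraction-injective : ∀ a b c d .{{_ : ℕ.NonZero b}} →
  Coprime a b → Coprime c d → a ℕ.* d ≡ c ℕ.* b → a ≡ c × b ≡ d
reduced-fraction-injective a b c d cop-ab cop-cd ad≡cb =
  ℕ.*-cancelʳ-≡ a c b (trans (cong (a ℕ.*_) b≡d) ad≡cb) , b≡d
  where
  b∣d : b ∣ d
  b∣d = coprime-divisor (Coprime.sym cop-ab) (subst (b ∣_) (sym ad≡cb) (n∣m*n c))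
  d∣b : d ∣ b
  d∣b = coprime-divisor (Coprime.sym cop-cd) (subst (d ∣_) ad≡cb (n∣m*n a))
  b≡d : b ≡ d
  b≡d = ∣-antisym b∣d d∣b

[x+1]²/x-cross : ∀ x x' → x' * x ≡ (x + 1ℚ) * (x + 1ℚ) →
  ∣ ↥ x' ∣ ℕ.* (∣ ↥ x ∣ ℕ.* ↧ₙ x) ≡ ∣ ↥ x ℤ.+ ↧ x ∣ ℕ.* ∣ ↥ x ℤ.+ ↧ x ∣ ℕ.* ↧ₙ x'
[x+1]²/x-cross x@(mkℚ A d-1 _) x'@(mkℚ A' d'-1 _) eq = ℕ.*-cancelʳ-≡ _ _ d (begin
  ∣ A' ∣ ℕ.* (∣ A ∣ ℕ.* d) ℕ.* d                 ≡⟨ shuffle ∣ A' ∣ ∣ A ∣ d ⟩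
  ∣ A' ∣ ℕ.* ∣ A ∣ ℕ.* ((d ℕ.* 1) ℕ.* (d ℕ.* 1)) ≡⟨ cong (ℕ._* _) (ℤ.abs-* A' A) ⟨
  ∣ A' ℤ.* A ∣ ℕ.* ((d ℕ.* 1) ℕ.* (d ℕ.* 1))     ≡⟨ ℤ.abs-* (A' ℤ.* A) _ ⟨
  ∣ A' ℤ.* A ℤ.* + ((d ℕ.* 1) ℕ.* (d ℕ.* 1)) ∣   ≡⟨ cong ∣_∣ (ℚᵘ.drop-*≡* cross) ⟩
  ∣ T ℤ.* T ℤ.* + (d' ℕ.* d) ∣                   ≡⟨ ℤ.abs-* (T ℤ.* T) _ ⟩
  ∣ T ℤ.* T ∣ ℕ.* (d' ℕ.* d)                     ≡⟨ cong (ℕ._* _) (ℤ.abs-* T T) ⟩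
  ∣ T ∣ ℕ.* ∣ T ∣ ℕ.* (d' ℕ.* d)                 ≡⟨ cong (λ t → ∣ t ∣ ℕ.* ∣ t ∣ ℕ.* _) T≡A+d ⟩
  s ℕ.* s ℕ.* (d' ℕ.* d)                         ≡⟨ ℕ.*-assoc (s ℕ.* s) d' d ⟨
  s ℕ.* s ℕ.* d' ℕ.* d                           ∎)
  where
  open ≡-Reasoning
  d = suc d-1
  d' = suc d'-1
  -- T and the factors `ℕ.* 1` are how ℚᵘ writes the unreduced numerator and denominator of x + 1.
  T = A ℤ.* + 1 ℤ.+ + 1 ℤ.* + d
  s = ∣ A ℤ.+ + d ∣
  T≡A+d : T ≡ A ℤ.+ + d
  T≡A+d = cong₂ ℤ._+_ (ℤ.*-identityʳ A) (ℤ.*-identityˡ (+ d))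
  shuffle : ∀ a b c → a ℕ.* (b ℕ.* c) ℕ.* c ≡ a ℕ.* b ℕ.* ((c ℕ.* 1) ℕ.* (c ℕ.* 1))
  shuffle = ℕ-Solver.solve-∀
  cross : toℚᵘ x' ℚᵘ.* toℚᵘ x ℚᵘ.≃ (toℚᵘ x ℚᵘ.+ ℚᵘ.1ℚᵘ) ℚᵘ.* (toℚᵘ x ℚᵘ.+ ℚᵘ.1ℚᵘ)
  cross = ℚᵘ.≃-trans (ℚᵘ.≃-sym (toℚᵘ-homo-* x' x))
    (ℚᵘ.≃-trans (toℚᵘ-cong eq)
    (ℚᵘ.≃-trans (toℚᵘ-homo-* (x + 1ℚ) (x + 1ℚ))
      (ℚᵘ.*-cong (toℚᵘ-homo-+ x 1ℚ) (toℚᵘ-homo-+ x 1ℚ))))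

[x+1]²/x-lowestTerms : ∀ x x' → x' * x ≡ (x + 1ℚ) * (x + 1ℚ) →
  ∣ ↥ x' ∣ ≡ ∣ ↥ x ℤ.+ ↧ x ∣ ℕ.* ∣ ↥ x ℤ.+ ↧ x ∣ × ↧ₙ x' ≡ ∣ ↥ x ∣ ℕ.* ↧ₙ x
[x+1]²/x-lowestTerms x@(mkℚ A d-1 cop) x'@(mkℚ A' d'-1 cop') eq =
  reduced-fraction-injective _ _ _ _ (Coprime.recompute cop') cop-s²-AD ([x+1]²/x-cross x x' eq)
  where
  cop-s-AD : Coprime ∣ A ℤ.+ + suc d-1 ∣ (∣ A ∣ ℕ.* suc d-1)
  cop-A-D = Coprime.recompute cop
  cop-s-AD = coprime-*ʳ (coprime-+ˡ A _ cop-A-D) (coprime-+ʳ A _ cop-A-D)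
  cop-s²-AD : Coprime (∣ A ℤ.+ + suc d-1 ∣ ℕ.* ∣ A ℤ.+ + suc d-1 ∣) (∣ A ∣ ℕ.* suc d-1)
  cop-s²-AD = Coprime.sym (coprime-*ʳ (Coprime.sym cop-s-AD) (Coprime.sym cop-s-AD))

[x+1]²/x-nonZero : ∀ x x' → x' * x ≡ (x + 1ℚ) * (x + 1ℚ) → ∣ ↥ x ∣ ≢ 0
[x+1]²/x-nonZero x x' eq ∣↥x∣≡0 = 1≢0 (begin
  1ℚ                    ≡⟨⟩
  (0ℚ + 1ℚ) * (0ℚ + 1ℚ) ≡⟨ cong (λ y → (y + 1ℚ) * (y + 1ℚ)) x≡0 ⟨
  (x + 1ℚ) * (x + 1ℚ)   ≡⟨ eq ⟨
  x' * x                ≡⟨ cong (x' *_) x≡0 ⟩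
  x' * 0ℚ               ≡⟨ *-zeroʳ x' ⟩
  0ℚ                    ∎)
  where
  open ≡-Reasoning
  x≡0 = ↥p≡0⇒p≡0 x (ℤ.∣i∣≡0⇒i≡0 ∣↥x∣≡0)

∣↥∣≡1∧∣↥+↧∣≡1⇒≡-½ : ∀ x → ∣ ↥ x ∣ ≡ 1 → ∣ ↥ x ℤ.+ ↧ x ∣ ≡ 1 → x ≡ -½
∣↥∣≡1∧∣↥+↧∣≡1⇒≡-½ (mkℚ -[1+ 0 ] 1 _) _ _ = refl
∣↥∣≡1∧∣↥+↧∣≡1⇒≡-½ (mkℚ -[1+ 0 ] 0 _) _ ()
∣↥∣≡1∧∣↥+↧∣≡1⇒≡-½ (mkℚ -[1+ 0 ] (suc (suc _)) _) _ ()
∣↥∣≡1∧∣↥+↧∣≡1⇒≡-½ (mkℚ (+ 1) _ _) _ ()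
∣↥∣≡1∧∣↥+↧∣≡1⇒≡-½ (mkℚ (+ 0) _ _) ()
∣↥∣≡1∧∣↥+↧∣≡1⇒≡-½ (mkℚ (+ suc (suc _)) _ _) ()
∣↥∣≡1∧∣↥+↧∣≡1⇒≡-½ (mkℚ -[1+ suc _ ] _ _) ()

-p≡p⇒p≡0 : ∀ p → - p ≡ p → p ≡ 0ℚ
-p≡p⇒p≡0 p -p≡p = ↥p≡0⇒p≡0 p (-i≡i⇒i≡0 (↥ p) (trans (sym (↥-neg p)) (cong ↥_ -p≡p)))
  where
  -i≡i⇒i≡0 : ∀ i → ℤ.- i ≡ i → i ≡ + 0
  -i≡i⇒i≡0 (+ 0)       _  = refl
  -i≡i⇒i≡0 (+ suc _)   ()
  -i≡i⇒i≡0 -[1+ _ ]    ()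

iter-suc : ∀ (f : P1 → P1) n P → iter f (suc n) P ≡ iter f n (f P)
iter-suc f zero    P = refl
iter-suc f (suc n) P = cong f (iter-suc f n P)

iter-fixed : ∀ (f : P1 → P1) {P} n → f P ≡ P → iter f n P ≡ P
iter-fixed f zero    fP≡P = refl
iter-fixed f (suc n) fP≡P = trans (cong f (iter-fixed f n fP≡P)) fP≡P

periodic-image : ∀ (f : P1 → P1) {P} → IsPeriodic f P → IsPeriodic f (f P)
periodic-image f {P} (n , per) = n , trans (sym (iter-suc f (suc n) P)) (cong f per)

involution⇒exactPeriod₂ : ∀ {f : P1 → P1} {P} → f P ≢ P → f (f P) ≡ P → HasExactPeriod f P 2
involution⇒exactPeriod₂ {f} {P} fP≢P ffP≡P = s≤s z≤n , ffP≡P , minimal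
  where
  minimal : ∀ m → 1 ℕ.≤ m → iter f m P ≡ P → 2 ℕ.≤ m
  minimal 1             _ fP≡P = contradiction fP≡P fP≢P
  minimal (suc (suc _)) _ _    = s≤s (s≤s z≤n)

module Dynamics (b : ℚ) .{{_ : NonZero b}} where
  next : (z : ℚ) → z ≢ 0ℚ → ℚ
  next z z≢0 = z + (b ÷ z) {{≢-nonZero z≢0}}

  φ-just : ∀ z (z≢0 : z ≢ 0ℚ) → φ b (just z) ≡ just (next z z≢0)
  φ-just z z≢0 with z ≟ 0ℚ
  ... | yes z≡0 = contradiction z≡0 z≢0
  ... | no _    = refl

  X : ℚ → ℚ
  X z = z * z * 1/ b

  X-next : ∀ z z≢0 → X (next z z≢0) * X z ≡ (X z + 1ℚ) * (X z + 1ℚ)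
  X-next z z≢0 = begin
    (z + b * w) * (z + b * w) * c * (z * z * c)
      ≡⟨ expand z w b c ⟩
    c * c * ((z * z + b * (z * w)) * (z * z + b * (z * w)))
      ≡⟨ cong (λ t → c * c * ((z * z + b * t) * (z * z + b * t))) (*-inverseʳ z) ⟩
    c * c * ((z * z + b * 1ℚ) * (z * z + b * 1ℚ))
      ≡⟨ factor z b c ⟩
    (z * z * c + b * c) * (z * z * c + b * c)
      ≡⟨ cong (λ t → (z * z * c + t) * (z * z * c + t)) (*-inverseʳ b) ⟩
    (z * z * c + 1ℚ) * (z * z * c + 1ℚ)
      ∎
    where
    open ≡-Reasoning
    instance _ = ≢-nonZero z≢0
    w = 1/ z
    c = 1/ b
    expand : ∀ z w b c → (z + b * w) * (z + b * w) * c * (z * z * c) ≡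
                         c * c * ((z * z + b * (z * w)) * (z * z + b * (z * w)))
    expand = solve 4 (λ z w b c →
      (z :+ b :* w) :* (z :+ b :* w) :* c :* (z :* z :* c) :=
      c :* c :* ((z :* z :+ b :* (z :* w)) :* (z :* z :+ b :* (z :* w)))) refl
    factor : ∀ z b c → c * c * ((z * z + b * 1ℚ) * (z * z + b * 1ℚ)) ≡
                       (z * z * c + b * c) * (z * z * c + b * c)
    factor = solve 3 (λ z b c →
      c :* c :* ((z :* z :+ b :* con 1ℚ) :* (z :* z :+ b :* con 1ℚ)) :=
      (z :* z :* c :+ b :* c) :* (z :* z :* c :+ b :* c)) refl

  X-next-lowestTerms : ∀ z z≢0 →
    ∣ ↥ X (next z z≢0) ∣ ≡ ∣ ↥ X z ℤ.+ ↧ X z ∣ ℕ.* ∣ ↥ X z ℤ.+ ↧ X z ∣ ×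
    ↧ₙ X (next z z≢0) ≡ ∣ ↥ X z ∣ ℕ.* ↧ₙ X z
  X-next-lowestTerms z z≢0 = [x+1]²/x-lowestTerms (X z) (X (next z z≢0)) (X-next z z≢0)

  ∣↥X∣≢0 : ∀ z → z ≢ 0ℚ → ∣ ↥ X z ∣ ≢ 0
  ∣↥X∣≢0 z z≢0 = [x+1]²/x-nonZero (X z) (X (next z z≢0)) (X-next z z≢0)

  ↧X≤↧X-next : ∀ z z≢0 → ↧ₙ X z ℕ.≤ ↧ₙ X (next z z≢0)
  ↧X≤↧X-next z z≢0 = ℕ.≤-trans (ℕ.m≤n*m (↧ₙ X z) ∣ ↥ X z ∣)
                                (ℕ.≤-reflexive (sym (proj₂ (X-next-lowestTerms z z≢0))))
    where instance _ = ℕ.≢-nonZero (∣↥X∣≢0 z z≢0)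

  iter-suc-next : ∀ m z z≢0 → iter (φ b) (suc m) (just z) ≡ iter (φ b) m (just (next z z≢0))
  iter-suc-next m z z≢0 = trans (iter-suc (φ b) m (just z)) (cong (iter (φ b) m) (φ-just z z≢0))

  iter-from-0 : ∀ m → iter (φ b) (suc m) (just 0ℚ) ≡ ∞
  iter-from-0 m = trans (iter-suc (φ b) m (just 0ℚ)) (iter-fixed (φ b) m refl)

  ↧X-mono : ∀ m {z y} → iter (φ b) m (just z) ≡ just y → ↧ₙ X z ℕ.≤ ↧ₙ X y
  ↧X-mono zero    refl = ℕ.≤-refl
  ↧X-mono (suc m) {z} orbit with z ≟ 0ℚ
  ... | yes refl = contradiction (trans (sym (iter-from-0 m)) orbit) λ ()
  ... | no z≢0   = ℕ.≤-trans (↧X≤↧X-next z z≢0)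
                             (↧X-mono m (trans (sym (iter-suc-next m z z≢0)) orbit))

  periodic⇒≢0 : ∀ {z} → IsPeriodic (φ b) (just z) → z ≢ 0ℚ
  periodic⇒≢0 (n , orbit) refl = contradiction (trans (sym (iter-from-0 n)) orbit) λ ()

  periodic-next : ∀ {z} (per : IsPeriodic (φ b) (just z)) →
    IsPeriodic (φ b) (just (next z (periodic⇒≢0 per)))
  periodic-next {z} per =
    subst (IsPeriodic (φ b)) (φ-just z (periodic⇒≢0 per)) (periodic-image (φ b) per)

  periodic⇒∣↥X∣≡1 : ∀ z → IsPeriodic (φ b) (just z) → ∣ ↥ X z ∣ ≡ 1
  periodic⇒∣↥X∣≡1 z per@(n , orbit) =
    ℕ.≤-antisym (ℕ.*-cancelʳ-≤ ∣ ↥ X z ∣ 1 (↧ₙ X z) AD≤D) (ℕ.n≢0⇒n>0 (∣↥X∣≢0 z z≢0))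
    where
    z≢0 = periodic⇒≢0 per
    AD≤D : ∣ ↥ X z ∣ ℕ.* ↧ₙ X z ℕ.≤ 1 ℕ.* ↧ₙ X z
    AD≤D = subst₂ ℕ._≤_ (proj₂ (X-next-lowestTerms z z≢0)) (sym (ℕ.*-identityˡ _))
             (↧X-mono n (trans (sym (iter-suc-next n z z≢0)) orbit))

  periodic⇒X≡-½ : ∀ z → IsPeriodic (φ b) (just z) → X z ≡ -½
  periodic⇒X≡-½ z per = ∣↥∣≡1∧∣↥+↧∣≡1⇒≡-½ (X z) (periodic⇒∣↥X∣≡1 z per) (ℕ.m*n≡1⇒n≡1 s s s²≡1)
    where
    s = ∣ ↥ X z ℤ.+ ↧ X z ∣
    s²≡1 : s ℕ.* s ≡ 1
    s²≡1 = trans (sym (proj₁ (X-next-lowestTerms z (periodic⇒≢0 per))))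
                 (periodic⇒∣↥X∣≡1 _ (periodic-next per))

  X≡-½⇒φ≡neg : ∀ z (z≢0 : z ≢ 0ℚ) → X z ≡ -½ → φ b (just z) ≡ just (- z)
  X≡-½⇒φ≡neg z z≢0 X≡-½ = trans (φ-just z z≢0) (cong just (begin
    z + b * w
      ≡⟨ split z w b c ⟩
    - z + (z + z) * (1ℚ - z * w * (b * c)) + b * w * (z * z * c + z * z * c + 1ℚ)
      ≡⟨ cong₂ (λ u v → - z + (z + z) * (1ℚ - u) + b * w * (v + v + 1ℚ)) zw·bc≡1 X≡-½ ⟩
    - z + (z + z) * 0ℚ + b * w * 0ℚ
      ≡⟨ drop-zeros z (b * w) ⟩
    - z
      ∎))
    where
    open ≡-Reasoning
    instance _ = ≢-nonZero z≢0
    w = 1/ z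
    c = 1/ b
    zw·bc≡1 : z * w * (b * c) ≡ 1ℚ
    zw·bc≡1 = cong₂ _*_ (*-inverseʳ z) (*-inverseʳ b)
    split : ∀ z w b c → z + b * w ≡
      - z + (z + z) * (1ℚ - z * w * (b * c)) + b * w * (z * z * c + z * z * c + 1ℚ)
    split = solve 4 (λ z w b c → z :+ b :* w :=
      :- z :+ (z :+ z) :* (con 1ℚ :- z :* w :* (b :* c))
           :+ b :* w :* (z :* z :* c :+ z :* z :* c :+ con 1ℚ)) refl
    drop-zeros : ∀ z y → - z + (z + z) * 0ℚ + y * 0ℚ ≡ - z
    drop-zeros = solve 2 (λ z y → :- z :+ (z :+ z) :* con 0ℚ :+ y :* con 0ℚ := :- z) refl

  periodic⇒exactPeriod₂ : ∀ z → IsPeriodic (φ b) (just z) → HasExactPeriod (φ b) (just z) 2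
  periodic⇒exactPeriod₂ z per = involution⇒exactPeriod₂ φz≢z (trans (cong (φ b) φz≡-z) φ-z≡z)
    where
    z≢0 = periodic⇒≢0 per
    φz≡-z : φ b (just z) ≡ just (- z)
    φz≡-z = X≡-½⇒φ≡neg z z≢0 (periodic⇒X≡-½ z per)
    -z≢0 : - z ≢ 0ℚ
    -z≢0 = periodic⇒≢0 (subst (IsPeriodic (φ b)) φz≡-z (periodic-image (φ b) per))
    X-neg : ∀ z c → - z * - z * c ≡ z * z * c
    X-neg = solve 2 (λ z c → :- z :* :- z :* c := z :* z :* c) refl
    neg-involutive : ∀ z → - - z ≡ z
    neg-involutive = solve 1 (λ z → :- :- z := z) refl
    φ-z≡z : φ b (just (- z)) ≡ just z
    φ-z≡z = trans (X≡-½⇒φ≡neg (- z) -z≢0 (trans (X-neg z (1/ b)) (periodic⇒X≡-½ z per)))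
                  (cong just (neg-involutive z))
    φz≢z : φ b (just z) ≢ just z
    φz≢z φz≡z = z≢0 (-p≡p⇒p≡0 z (just-injective (trans (sym φz≡-z) φz≡z)))

corollary4p2 : (b : ℚ) → b ≢ 0ℚ → (P : P1) → IsPeriodic (φ b) P →
    (P ≡ ∞) ⊎ HasExactPeriod (φ b) P 2
corollary4p2 b b≢0 nothing  _   = inj₁ refl
corollary4p2 b b≢0 (just z) per = inj₂ (Dynamics.periodic⇒exactPeriod₂ b {{≢-nonZero b≢0}} z per)
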